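{- Let $S[1..n]$ be a string and $1\le x\le y\le n$. If $\mathrm{LR}_x^y$ exists, then every choice of $\mathrm{LR}_x^y$ is a useful LLR of $S$.
   Context: $S[i..j]=S[i]\cdots S[j]$. A substring $S[i..j]$ covers $[x..y]$ if $i\le x\le y\le j$. A substring $S[i..j]$ is unique if there is no other substring $S[i'..j']$ with $S[i'..j']=S[i..j]$ and $i'\ne i$; a repeat is a non-unique substring. $\mathrm{LR}_x^y$ (longest repeat covering $[x..y]$) is a repeat $S[i..j]$ covering $[x..y]$ such that no repeat $S[i'..j']$ covering $[x..y]$ has $j'-i'>j-i$. The left-bounded longest repeat starting at position $k$, $\mathrm{LLR}_k$, is a repeat $S[k..j]$ such that either $j=n$ or $S[k..j+1]$ is unique (it exists iff $S[k]$ is not unique). An LLR is useless if it is a substring (occupying a sub-interval of positions, i.e. a proper substring in position terms: $S[i'..j']$ with $i\le i'\le j'\le j$ and $j'-i'<j-i$) of another LLR $S[i..j]$; otherwise it is useful. -}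

module Defs where

open import Data.Nat using (ℕ; suc; _+_; _∸_; _≤_; _<_)
open import Data.Product using (Σ; _×_; ∃-syntax)
open import Data.Sum using (_⊎_)
open import Relation.Nullary using (¬_)
open import Relation.Binary.PropositionalEquality using (_≡_; _≢_)

-- A string S[1..n] over an alphabet A is given by its length n and a
-- function S : ℕ → A; only the values S 1, …, S n are meaningful, and all
-- definitions below only inspect positions inside [1..n].

ValidInterval : ℕ → ℕ → ℕ → Set
ValidInterval n i j = 1 ≤ i × i ≤ j × j ≤ n

SameSubstring : {A : Set} → (ℕ → A) → ℕ → ℕ → ℕ → ℕ → Set
SameSubstring S i j i' j' =
  (j ∸ i ≡ j' ∸ i') × (∀ k → k ≤ j ∸ i → S (i + k) ≡ S (i' + k))

Repeat : {A : Set} → ℕ → (ℕ → A) → ℕ → ℕ → Set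
Repeat n S i j =
  ValidInterval n i j ×
  (∃[ i' ] ∃[ j' ] (ValidInterval n i' j' × i' ≢ i × SameSubstring S i j i' j'))

Unique : {A : Set} → ℕ → (ℕ → A) → ℕ → ℕ → Set
Unique n S i j = ValidInterval n i j × ¬ Repeat n S i j

Covers : ℕ → ℕ → ℕ → ℕ → Set
Covers i j x y = i ≤ x × x ≤ y × y ≤ j

IsLR : {A : Set} → ℕ → (ℕ → A) → ℕ → ℕ → ℕ → ℕ → Set
IsLR n S x y i j =
  Repeat n S i j × Covers i j x y ×
  (∀ i' j' → Repeat n S i' j' → Covers i' j' x y → j' ∸ i' ≤ j ∸ i)

IsLLR : {A : Set} → ℕ → (ℕ → A) → ℕ → ℕ → Set
IsLLR n S k j = Repeat n S k j × (j ≡ n ⊎ Unique n S k (suc j))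

UselessLLR : {A : Set} → ℕ → (ℕ → A) → ℕ → ℕ → Set
UselessLLR n S k j =
  ∃[ i ] ∃[ j' ] (IsLLR n S i j' × i ≤ k × j ≤ j' × j ∸ k < j' ∸ i)

UsefulLLR : {A : Set} → ℕ → (ℕ → A) → ℕ → ℕ → Set
UsefulLLR n S k j = IsLLR n S k j × ¬ UselessLLR n S k j

module Submission where

-- The
-- whole proof rests on one observation: every interval containing a
-- covering interval still covers [x..y] (covers-widen), so any repeat
-- obtained by enlarging LR_x^y would be a longer covering repeat,
-- contradicting maximality (LR-maximal-against-wider).
--
-- Two instances of this observation give the theorem:
--   * enlarging S[i..j] to S[i..j+1]: the extension is not a repeat, so
--     S[i..j] is LLR_i (LR-is-LLR);
--   * enlarging S[i..j] to any LLR S[i'..j'] properly containing it: that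
--     LLR is a repeat, so it cannot be strictly longer (LR-not-useless).

open import Defs
open import Data.Nat using (ℕ; suc; _∸_; _≤_; _<_)
open import Data.Nat.Properties
  using (≤-trans; ≤-refl; <⇒≱; 1+n≰n; m≤n⇒m≤1+n; m≤n⇒m<n∨m≡n; +-∸-assoc)
open import Data.Product using (_,_)
open import Data.Sum using (_⊎_; inj₁; inj₂)
open import Relation.Nullary using (¬_)
open import Relation.Binary.PropositionalEquality using (_≡_; subst)

covers-widen : ∀ {i j i' j' x y} → i' ≤ i → j ≤ j' →
  Covers i j x y → Covers i' j' x y
covers-widen i'≤i j≤j' (i≤x , x≤y , y≤j) =
  ≤-trans i'≤i i≤x , x≤y , ≤-trans y≤j j≤j'

module _ {A : Set} (n : ℕ) (S : ℕ → A) where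

  LR-maximal-against-wider : ∀ {x y i j i' j'} →
    IsLR n S x y i j → Repeat n S i' j' → i' ≤ i → j ≤ j' →
    j' ∸ i' ≤ j ∸ i
  LR-maximal-against-wider (_ , covers , longest) rep' i'≤i j≤j' =
    longest _ _ rep' (covers-widen i'≤i j≤j' covers)

  LR-extension-not-repeat : ∀ {x y i j} →
    IsLR n S x y i j → ¬ Repeat n S i (suc j)
  LR-extension-not-repeat {i = i} {j} lr@(((_ , i≤j , _) , _) , _) rep⁺ =
    1+n≰n (subst (_≤ j ∸ i) (+-∸-assoc 1 i≤j) longer-fits)
    where
    longer-fits : suc j ∸ i ≤ j ∸ i
    longer-fits = LR-maximal-against-wider lr rep⁺ ≤-refl (m≤n⇒m≤1+n ≤-refl)

  LR-is-LLR : ∀ {x y i j} →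
    IsLR n S x y i j → IsLLR n S i j
  LR-is-LLR {i = i} {j} lr@(rep@((1≤i , i≤j , j≤n) , _) , _) =
    rep , right-end
    where
    right-end : j ≡ n ⊎ Unique n S i (suc j)
    right-end with m≤n⇒m<n∨m≡n j≤n
    ... | inj₂ j≡n = inj₁ j≡n
    ... | inj₁ j<n =
      inj₂ ((1≤i , m≤n⇒m≤1+n i≤j , j<n) , LR-extension-not-repeat lr)

  LR-not-useless : ∀ {x y i j} →
    IsLR n S x y i j → ¬ UselessLLR n S i j
  LR-not-useless lr (_ , _ , (rep' , _) , i'≤i , j≤j' , strictly-longer) =
    <⇒≱ strictly-longer (LR-maximal-against-wider lr rep' i'≤i j≤j')

lemma3 : {A : Set} (n : ℕ) (S : ℕ → A) (x y : ℕ) →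
    1 ≤ x → x ≤ y → y ≤ n →
    (i j : ℕ) → IsLR n S x y i j → UsefulLLR n S i j
lemma3 n S x y _ _ _ i j lr = LR-is-LLR n S lr , LR-not-useless n S lr
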